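{- Let $\varphi\in\mathrm{Fm}_{\mathsf S}$ and $a,b\in Ag$ with $a\neq b$. Then: (1) $\vdash_{\mathsf S}\neg S_{a,a}\varphi$; (2) $\vdash_{\mathsf S}\neg S_{a,b}\top$ and $\vdash_{\mathsf S}\neg S_{a,b}\bot$; (3) $\vdash_{\mathsf S}S_{a,b}\varphi\to\varphi$; (4) $\vdash_{\mathsf S}S_{a,b}\varphi\to K_aS_{a,b}\varphi$; (5) $\vdash_{\mathsf S}S_{a,b}\varphi\leftrightarrow S_{a,b}S_{a,b}\varphi$; (6) $\vdash_{\mathsf S}\neg K_b\varphi\to\neg K_bS_{a,b}\varphi$; (7) $\vdash_{\mathsf S}S_{a,b}\varphi\to\neg S_{a,b}\neg\varphi$; (8) $\vdash_{\mathsf S}S_{a,b}\varphi\to S_{a,b}K_a\varphi$; (9) $\vdash_{\mathsf S}\neg S_{a,b}S_{b,a}\varphi$.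
   Context: Let $Ag$ be a non-empty finite set of agents and $Var$ a countably infinite set of propositional variables. The formulas $\mathrm{Fm}_{\mathsf S}$ are generated by $\varphi::=p\mid\neg\varphi\mid\varphi\land\varphi\mid I_a\varphi\mid K_a\varphi\mid B_a\varphi$ ($p\in Var$, $a\in Ag$), with $\lor,\to,\leftrightarrow$ classical abbreviations, $\top$ a classical tautology (e.g. $p\lor\neg p$) and $\bot:=\neg\top$. The logic $\mathsf S$ ($\vdash_{\mathsf S}\varphi$ means $\varphi$ is derivable) has as axioms: all classical tautologies; for each $a$ and $\star\in\{K_a,B_a,I_a\}$, $\star(\varphi\to\psi)\to(\star\varphi\to\star\psi)$; $K_a\varphi\to\varphi$; $K_a\varphi\to K_aK_a\varphi$; $B_a\varphi\to\neg B_a\neg\varphi$; $K_a\varphi\to B_a\varphi$; $B_a\varphi\to K_aB_a\varphi$; $I_a\varphi\to\neg I_a\neg\varphi$; $I_a\varphi\to K_aI_a\varphi$; $I_a\varphi\to I_aK_a\varphi$; $I_a\varphi\to I_aI_a\varphi$; rules: modus ponens and necessitation for each $K_a,B_a,I_a$. For agents $a,b$ (not necessarily distinct) and a formula $\varphi$, the secrecy formula is $S_{a,b}\varphi:=K_a\varphi\land B_a\neg K_b\varphi\land I_a(\varphi\land\neg K_b\varphi)$. -}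

module Defs where

open import Data.Nat using (ℕ; suc)
open import Data.Fin using (Fin)
open import Data.Bool using (Bool; true; false; not; _∧_)
open import Relation.Binary.PropositionalEquality using (_≡_)

Var : Set
Var = ℕ

module Logic (n : ℕ) where

  Ag : Set
  Ag = Fin (suc n)

  infix 8 ¬'_
  infixr 6 _∧'_
  infixr 5 _∨'_
  infixr 4 _⇒_
  infix 3 _⇔_
  infix 1 ⊢_
  data Fm : Set where
    var  : Var → Fm
    ¬'_  : Fm → Fm
    _∧'_ : Fm → Fm → Fm
    I    : Ag → Fm → Fm
    K    : Ag → Fm → Fm
    B    : Ag → Fm → Fm

  _∨'_ : Fm → Fm → Fm
  φ ∨' ψ = ¬' (¬' φ ∧' ¬' ψ)

  _⇒_ : Fm → Fm → Fm
  φ ⇒ ψ = ¬' (φ ∧' ¬' ψ)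

  _⇔_ : Fm → Fm → Fm
  φ ⇔ ψ = (φ ⇒ ψ) ∧' (ψ ⇒ φ)

  ⊤' : Fm
  ⊤' = var 0 ∨' ¬' var 0

  ⊥' : Fm
  ⊥' = ¬' ⊤'

  -- Classical tautologies: modal subformulas I_a φ, K_a φ, B_a φ are
  -- treated as propositional atoms (arbitrary truth values).
  record Valuation : Set where
    field
      vVar : Var → Bool
      vI   : Ag → Fm → Bool
      vK   : Ag → Fm → Bool
      vB   : Ag → Fm → Bool

  open Valuation

  ⟦_⟧ : Fm → Valuation → Bool
  ⟦ var p ⟧ v = vVar v p
  ⟦ ¬' φ ⟧ v = not (⟦ φ ⟧ v)
  ⟦ φ ∧' ψ ⟧ v = ⟦ φ ⟧ v ∧ ⟦ ψ ⟧ v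
  ⟦ I a φ ⟧ v = vI v a φ
  ⟦ K a φ ⟧ v = vK v a φ
  ⟦ B a φ ⟧ v = vB v a φ

  Tautology : Fm → Set
  Tautology φ = (v : Valuation) → ⟦ φ ⟧ v ≡ true

  data ⊢_ : Fm → Set where
    taut   : ∀ {φ} → Tautology φ → ⊢ φ
    K-I    : ∀ {a φ ψ} → ⊢ (I a (φ ⇒ ψ) ⇒ (I a φ ⇒ I a ψ))
    K-K    : ∀ {a φ ψ} → ⊢ (K a (φ ⇒ ψ) ⇒ (K a φ ⇒ K a ψ))
    K-B    : ∀ {a φ ψ} → ⊢ (B a (φ ⇒ ψ) ⇒ (B a φ ⇒ B a ψ))
    T-K    : ∀ {a φ} → ⊢ (K a φ ⇒ φ)
    4-K    : ∀ {a φ} → ⊢ (K a φ ⇒ K a (K a φ))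
    D-B    : ∀ {a φ} → ⊢ (B a φ ⇒ ¬' B a (¬' φ))
    KB     : ∀ {a φ} → ⊢ (K a φ ⇒ B a φ)
    BKB    : ∀ {a φ} → ⊢ (B a φ ⇒ K a (B a φ))
    D-I    : ∀ {a φ} → ⊢ (I a φ ⇒ ¬' I a (¬' φ))
    IKI    : ∀ {a φ} → ⊢ (I a φ ⇒ K a (I a φ))
    IIK    : ∀ {a φ} → ⊢ (I a φ ⇒ I a (K a φ))
    4-I    : ∀ {a φ} → ⊢ (I a φ ⇒ I a (I a φ))
    mp     : ∀ {φ ψ} → ⊢ (φ ⇒ ψ) → ⊢ φ → ⊢ ψ
    nec-K  : ∀ {a φ} → ⊢ φ → ⊢ K a φ
    nec-B  : ∀ {a φ} → ⊢ φ → ⊢ B a φ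
    nec-I  : ∀ {a φ} → ⊢ φ → ⊢ I a φ

  S : Ag → Ag → Fm → Fm
  S a b φ = K a φ ∧' (B a (¬' K b φ) ∧' I a (φ ∧' ¬' K b φ))

-- If a knows that b knows φ, then a believes K_b φ, which by D contradicts B_a ¬K_b φ; this
-- refutes S_{a,b} φ in (1) (axiom 4), (2) for ⊤ (necessitation) and (9) (introspection (4)
-- of S_{b,a}). Each conjunct of S_{a,b} φ is known to a, giving (4). With χ = φ ∧ ¬K_b φ,
-- I_a χ implies I_a (K_a χ ∧ I_a χ), and K_a χ ∧ I_a χ implies S_{a,b} φ; so S_{a,b} φ
-- implies S_{a,b} ψ whenever it implies ψ and ¬K_b φ implies ¬K_b ψ, giving (5) and (8).
-- Propositional reasoning is by instances of schemas validated by truth tables.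
module Submission where

open import Defs
open import Data.Bool using (Bool; true; false; not; _∧_; T)
open import Data.Bool.Properties using (T-∧; T-≡)
open import Data.Fin using (Fin; zero; suc)
open import Data.Nat using (ℕ; zero; suc)
open import Data.Product using (_×_; _,_; proj₁; proj₂)
open import Data.Vec using (Vec; []; _∷_; lookup; map)
open import Data.Vec.Properties using (lookup-map)
open import Function using (_∘_)
open import Function.Bundles using (module Equivalence)
open import Relation.Binary.PropositionalEquality using (_≡_; sym; cong; cong₂; trans)
open import Relation.Nullary using (¬_)

open Equivalence using (to)

infixr 6 _&_
infixr 4 _⊃_

data Schema (k : ℕ) : Set where
  ‵_  : Fin k → Schema k
  ~_  : Schema k → Schema k
  _&_ : Schema k → Schema k → Schema k

_⊃_ : ∀ {k} → Schema k → Schema k → Schema k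
s ⊃ t = ~ (s & ~ t)

x₀ : ∀ {k} → Schema (suc k)
x₀ = ‵ zero

x₁ : ∀ {k} → Schema (suc (suc k))
x₁ = ‵ suc zero

x₂ : ∀ {k} → Schema (suc (suc (suc k)))
x₂ = ‵ suc (suc zero)

eval : ∀ {k} → Vec Bool k → Schema k → Bool
eval ρ (‵ i)   = lookup ρ i
eval ρ (~ s)   = not (eval ρ s)
eval ρ (s & t) = eval ρ s ∧ eval ρ t

every : (k : ℕ) → (Vec Bool k → Bool) → Bool
every zero    f = f []
every (suc k) f = every k (f ∘ (true ∷_)) ∧ every k (f ∘ (false ∷_))

every-sound : ∀ k (f : Vec Bool k → Bool) → T (every k f) → ∀ ρ → T (f ρ)
every-sound zero    f p []          = p
every-sound (suc k) f p (true ∷ ρ)  = every-sound k _ (proj₁ (to T-∧ p)) ρ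
every-sound (suc k) f p (false ∷ ρ) = every-sound k _ (proj₂ (to T-∧ p)) ρ

Valid : ∀ {k} → Schema k → Set
Valid {k} s = T (every k (λ ρ → eval ρ s))

module Secrecy (n : ℕ) where
  open Logic n

  private
    variable
      a b : Ag
      φ ψ χ : Fm
      k : ℕ

  _⟨_⟩ : Schema k → Vec Fm k → Fm
  (‵ i)   ⟨ σ ⟩ = lookup σ i
  (~ s)   ⟨ σ ⟩ = ¬' s ⟨ σ ⟩
  (s & t) ⟨ σ ⟩ = s ⟨ σ ⟩ ∧' t ⟨ σ ⟩

  ⟦⟨⟩⟧ : (s : Schema k) (σ : Vec Fm k) (v : Valuation) →
         ⟦ s ⟨ σ ⟩ ⟧ v ≡ eval (map (λ θ → ⟦ θ ⟧ v) σ) s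
  ⟦⟨⟩⟧ (‵ i)   σ v = sym (lookup-map i (λ θ → ⟦ θ ⟧ v) σ)
  ⟦⟨⟩⟧ (~ s)   σ v = cong not (⟦⟨⟩⟧ s σ v)
  ⟦⟨⟩⟧ (s & t) σ v = cong₂ _∧_ (⟦⟨⟩⟧ s σ v) (⟦⟨⟩⟧ t σ v)

  tautology : (s : Schema k) {_ : Valid s} (σ : Vec Fm k) → ⊢ s ⟨ σ ⟩
  tautology {k} s {valid} σ = taut λ v →
    trans (⟦⟨⟩⟧ s σ v) (to T-≡ (every-sound k (λ ρ → eval ρ s) valid _))

  mp₂ : ⊢ φ ⇒ ψ ⇒ χ → ⊢ φ → ⊢ ψ → ⊢ χ
  mp₂ h p q = mp (mp h p) q

  ⊤-intro : ⊢ ⊤'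
  ⊤-intro = tautology (~ (~ x₀ & ~ ~ x₀)) (var 0 ∷ [])

  ⇒-refl : ⊢ φ ⇒ φ
  ⇒-refl {φ} = tautology (x₀ ⊃ x₀) (φ ∷ [])

  ⇒-const : ⊢ ψ → ⊢ φ ⇒ ψ
  ⇒-const {ψ} {φ} = mp (tautology (x₀ ⊃ x₁ ⊃ x₀) (ψ ∷ φ ∷ []))

  ⇒-trans : ⊢ φ ⇒ ψ → ⊢ ψ ⇒ χ → ⊢ φ ⇒ χ
  ⇒-trans {φ} {ψ} {χ} = mp₂ (tautology ((x₀ ⊃ x₁) ⊃ (x₁ ⊃ x₂) ⊃ (x₀ ⊃ x₂)) (φ ∷ ψ ∷ χ ∷ []))

  ∧-pair : ⊢ φ ⇒ ψ ⇒ φ ∧' ψ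
  ∧-pair {φ} {ψ} = tautology (x₀ ⊃ x₁ ⊃ x₀ & x₁) (φ ∷ ψ ∷ [])

  ∧-fst : ⊢ φ ∧' ψ ⇒ φ
  ∧-fst {φ} {ψ} = tautology (x₀ & x₁ ⊃ x₀) (φ ∷ ψ ∷ [])

  ∧-snd : ⊢ φ ∧' ψ ⇒ ψ
  ∧-snd {φ} {ψ} = tautology (x₀ & x₁ ⊃ x₁) (φ ∷ ψ ∷ [])

  ⇒-∧ : ⊢ φ ⇒ ψ → ⊢ φ ⇒ χ → ⊢ φ ⇒ ψ ∧' χ
  ⇒-∧ {φ} {ψ} {χ} = mp₂ (tautology ((x₀ ⊃ x₁) ⊃ (x₀ ⊃ x₂) ⊃ (x₀ ⊃ x₁ & x₂)) (φ ∷ ψ ∷ χ ∷ []))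

  ∧-map : ∀ {φ′ ψ′} → ⊢ φ ⇒ φ′ → ⊢ ψ ⇒ ψ′ → ⊢ φ ∧' ψ ⇒ φ′ ∧' ψ′
  ∧-map p q = ⇒-∧ (⇒-trans ∧-fst p) (⇒-trans ∧-snd q)

  ⇒-uncurry : ⊢ φ ⇒ ψ ⇒ χ → ⊢ φ ∧' ψ ⇒ χ
  ⇒-uncurry {φ} {ψ} {χ} = mp (tautology ((x₀ ⊃ x₁ ⊃ x₂) ⊃ (x₀ & x₁ ⊃ x₂)) (φ ∷ ψ ∷ χ ∷ []))

  contraposition : ⊢ φ ⇒ ψ → ⊢ ¬' ψ ⇒ ¬' φ
  contraposition {φ} {ψ} = mp (tautology ((x₀ ⊃ x₁) ⊃ (~ x₁ ⊃ ~ x₀)) (φ ∷ ψ ∷ []))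

  ⇒-¬ : ⊢ φ ⇒ χ → ⊢ ψ ⇒ ¬' χ → ⊢ φ ⇒ ¬' ψ
  ⇒-¬ {φ} {χ} {ψ} = mp₂ (tautology ((x₀ ⊃ x₁) ⊃ (x₂ ⊃ ~ x₁) ⊃ (x₀ ⊃ ~ x₂)) (φ ∷ χ ∷ ψ ∷ []))

  refute : ⊢ φ ⇒ ψ → ⊢ φ ⇒ ¬' ψ → ⊢ ¬' φ
  refute {φ} {ψ} = mp₂ (tautology ((x₀ ⊃ x₁) ⊃ (x₀ ⊃ ~ x₁) ⊃ ~ x₀) (φ ∷ ψ ∷ []))

  ⇔-intro : ⊢ φ ⇒ ψ → ⊢ ψ ⇒ φ → ⊢ φ ⇔ ψ
  ⇔-intro = mp₂ ∧-pair

  record Normal (□ : Fm → Fm) : Set where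
    field
      distrib : ⊢ □ (φ ⇒ ψ) ⇒ □ φ ⇒ □ ψ
      nec     : ⊢ φ → ⊢ □ φ

  open Normal

  □-mono : ∀ {□} → Normal □ → ⊢ φ ⇒ ψ → ⊢ □ φ ⇒ □ ψ
  □-mono N p = mp (distrib N) (nec N p)

  □-∧ : ∀ {□} → Normal □ → ⊢ □ φ ∧' □ ψ ⇒ □ (φ ∧' ψ)
  □-∧ N = ⇒-uncurry (⇒-trans (□-mono N ∧-pair) (distrib N))

  K-normal : Normal (K a)
  K-normal = record { distrib = K-K ; nec = nec-K }

  B-normal : Normal (B a)
  B-normal = record { distrib = K-B ; nec = nec-B }

  I-normal : Normal (I a)
  I-normal = record { distrib = K-I ; nec = nec-I }

  I⇒I[K∧I] : ⊢ I a φ ⇒ I a (K a φ ∧' I a φ)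
  I⇒I[K∧I] = ⇒-trans (⇒-∧ IIK 4-I) (□-∧ I-normal)

  hiddenFrom : Ag → Fm → Fm
  hiddenFrom b φ = φ ∧' ¬' K b φ

  S⇒K : ⊢ S a b φ ⇒ K a φ
  S⇒K = ∧-fst

  S⇒B : ⊢ S a b φ ⇒ B a (¬' K b φ)
  S⇒B = ⇒-trans ∧-snd ∧-fst

  K∧I⇒S : ⊢ K a (hiddenFrom b φ) ∧' I a (hiddenFrom b φ) ⇒ S a b φ
  K∧I⇒S = ⇒-∧ (⇒-trans ∧-fst (□-mono K-normal ∧-fst))
               (∧-map (⇒-trans (□-mono K-normal ∧-snd) KB) ⇒-refl)

  S-factive : ⊢ S a b φ ⇒ φ
  S-factive = ⇒-trans S⇒K T-K

  S-introspective : ⊢ S a b φ ⇒ K a (S a b φ)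
  S-introspective =
    ⇒-trans (∧-map 4-K (⇒-trans (∧-map BKB IKI) (□-∧ K-normal))) (□-∧ K-normal)

  ¬K⇒¬K-S : ⊢ ¬' K b φ ⇒ ¬' K b (S a b φ)
  ¬K⇒¬K-S = contraposition (□-mono K-normal S-factive)

  ¬S-of-K⇒KK : ⊢ K a φ ⇒ K a (K b φ) → ⊢ ¬' S a b φ
  ¬S-of-K⇒KK h = refute S⇒B (⇒-trans S⇒K (⇒-trans h (⇒-trans KB D-B)))

  S-mono : ⊢ S a b φ ⇒ ψ → ⊢ ¬' K b φ ⇒ ¬' K b ψ → ⊢ S a b φ ⇒ S a b ψ
  S-mono {a} {b} {φ} {ψ} h ¬K⇒¬K =
    ⇒-∧ (⇒-trans S-introspective (□-mono K-normal h))
        (⇒-trans ∧-snd (∧-map (□-mono B-normal ¬K⇒¬K)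
                              (⇒-trans I⇒I[K∧I] (□-mono I-normal K∧I⇒hidden))))
    where
      K∧I⇒hidden : ⊢ K a (hiddenFrom b φ) ∧' I a (hiddenFrom b φ) ⇒ hiddenFrom b ψ
      K∧I⇒hidden = ⇒-∧ (⇒-trans K∧I⇒S h)
                       (⇒-trans ∧-fst (⇒-trans T-K (⇒-trans ∧-snd ¬K⇒¬K)))

proposition2 : (n : ℕ) → let open Logic n in
    (φ : Fm) (a b : Ag) → ¬ (a ≡ b) →
      (⊢ (¬' S a a φ))
      × ((⊢ (¬' S a b ⊤')) × (⊢ (¬' S a b ⊥')))
      × (⊢ (S a b φ ⇒ φ))
      × (⊢ (S a b φ ⇒ K a (S a b φ)))
      × (⊢ (S a b φ ⇔ S a b (S a b φ)))
      × (⊢ (¬' K b φ ⇒ ¬' K b (S a b φ)))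
      × (⊢ (S a b φ ⇒ ¬' S a b (¬' φ)))
      × (⊢ (S a b φ ⇒ S a b (K a φ)))
      × (⊢ (¬' S a b (S b a φ)))
proposition2 n φ a b _ =
    ¬S-of-K⇒KK 4-K
  , (¬S-of-K⇒KK (⇒-const (nec-K (nec-K ⊤-intro))) , refute (⇒-const ⊤-intro) S-factive)
  , S-factive
  , S-introspective
  , ⇔-intro (S-mono ⇒-refl ¬K⇒¬K-S) S-factive
  , ¬K⇒¬K-S
  , ⇒-¬ S-factive S-factive
  , S-mono S⇒K (contraposition (□-mono K-normal T-K))
  , ¬S-of-K⇒KK (□-mono K-normal S-introspective)
  where open Logic n
        open Secrecy n
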